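{- Let $C$ be a $\mathbb{Z}_2$-linear code (a binary linear code). Then $C$ is a $\mathbb{Z}_2\mathbb{Z}_2[u]$-linear code with parameters $(\alpha,\beta)$ for some $\beta>0$ if and only if the automorphism group $\mathrm{Aut}(C)$ has even order.
   Context: Let $\mathbb{Z}_2[u]=\{0,1,u,1+u\}$ be the ring $\mathbb{Z}_2+u\mathbb{Z}_2$ with $u^2=0$. Define $\pi:\mathbb{Z}_2[u]\to\mathbb{Z}_2$ by $\pi(0)=\pi(u)=0$, $\pi(1)=\pi(1+u)=1$. The set $\mathbb{Z}_2^\alpha\times\mathbb{Z}_2[u]^\beta$ is a $\mathbb{Z}_2[u]$-module under componentwise addition and the scalar multiplication $\lambda(x_1,\dots,x_\alpha\mid x'_1,\dots,x'_\beta)=(\pi(\lambda)x_1,\dots,\pi(\lambda)x_\alpha\mid \lambda x'_1,\dots,\lambda x'_\beta)$. A $\mathbb{Z}_2\mathbb{Z}_2[u]$-additive code with parameters $(\alpha,\beta)$ is a $\mathbb{Z}_2[u]$-submodule of $\mathbb{Z}_2^\alpha\times\mathbb{Z}_2[u]^\beta$. Let $\psi:\mathbb{Z}_2[u]\to\mathbb{Z}_2^2$ be given by $\psi(0)=(0,0)$, $\psi(1)=(0,1)$, $\psi(u)=(1,1)$, $\psi(1+u)=(1,0)$, extended coordinatewise to $\mathbb{Z}_2[u]^\beta\to\mathbb{Z}_2^{2\beta}$, and let $\Psi(x\mid x')=(x\mid\psi(x'))\in\mathbb{Z}_2^{\alpha+2\beta}$. A binary code $C$ of length $\alpha+2\beta$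 is called $\mathbb{Z}_2\mathbb{Z}_2[u]$-linear with parameters $(\alpha,\beta)$ if, after a suitable permutation of its coordinates, $C=\Psi(\mathcal{C})$ for some $\mathbb{Z}_2\mathbb{Z}_2[u]$-additive code $\mathcal{C}$ with parameters $(\alpha,\beta)$ (equivalently, one chooses $\alpha$ coordinates and $\beta$ disjoint pairs of the remaining coordinates to play the role of the $\mathbb{Z}_2[u]$ coordinates). For a binary code $C$, $\mathrm{Aut}(C)$ is the group of coordinate permutations leaving $C$ invariant. -}

module Defs where

open import Data.Bool using (Bool; true; false; _∧_; _∨_; not; _xor_; T)
open import Data.Nat using (ℕ; zero; suc; _+_; _*_)
open import Data.Fin using (Fin; _≟_)
open import Data.Vec using (Vec; []; _∷_; map; lookup; zipWith; replicate; _++_; concat)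
open import Data.List using (List; []; _∷_; allFin; concatMap)
open import Data.Product using (Σ; _×_; _,_; ∃; ∃-syntax)
open import Relation.Nullary.Decidable using (⌊_⌋)
open import Relation.Binary.PropositionalEquality using (_≡_)
open import Function.Definitions using (Injective)

Word : ℕ → Set
Word n = Vec Bool n

Code : ℕ → Set
Code n = Word n → Bool

-- C is a Z₂-linear code: contains 0 and is closed under addition.
-- (Over Z₂ this is exactly being a Z₂-subspace.)
IsBinaryLinear : ∀ {n} → Code n → Set
IsBinaryLinear {n} C =
  T (C (replicate n false)) ×
  (∀ x y → T (C x) → T (C y) → T (C (zipWith _xor_ x y)))

allL : ∀ {A : Set} → (A → Bool) → List A → Bool
allL p []       = true
allL p (a ∷ as) = p a ∧ allL p as

allWords : (n : ℕ) → List (Word n)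
allWords zero    = [] ∷ []
allWords (suc n) = concatMap (λ w → (false ∷ w) ∷ (true ∷ w) ∷ []) (allWords n)

permute : ∀ {m n} → Vec (Fin n) m → Word n → Word m
permute σ w = map (lookup w) σ

isPermutation : ∀ {n} → Vec (Fin n) n → Bool
isPermutation {n} σ =
  allL (λ i → allL (λ j → not ⌊ lookup σ i ≟ lookup σ j ⌋ ∨ ⌊ i ≟ j ⌋) (allFin n)) (allFin n)

-- σ leaves C invariant: x ∈ C ⇒ x ∘ σ ∈ C (for a permutation of a
-- finite code this is equivalent to σ(C) = C).
leavesInvariant : ∀ {n} → Code n → Vec (Fin n) n → Bool
leavesInvariant {n} C σ = allL (λ x → not (C x) ∨ C (permute σ x)) (allWords n)

isAut : ∀ {n} → Code n → Vec (Fin n) n → Bool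
isAut C σ = isPermutation σ ∧ leavesInvariant C σ

Aut : ∀ {n} → Code n → Set
Aut {n} C = Σ (Vec (Fin n) n) (λ σ → T (isAut C σ))

open import Function.Bundles using (_↔_)

HasEvenOrder : Set → Set
HasEvenOrder A = ∃[ k ] (A ↔ Fin (2 * k))

-- The ring Z₂[u] = Z₂ + uZ₂, u² = 0

data Z2u : Set where
  𝟘 𝟙 𝕦 𝟙+𝕦 : Z2u

toPair : Z2u → Bool × Bool
toPair 𝟘   = false , false
toPair 𝟙   = true  , false
toPair 𝕦   = false , true
toPair 𝟙+𝕦 = true  , true

fromPair : Bool × Bool → Z2u
fromPair (false , false) = 𝟘
fromPair (true  , false) = 𝟙
fromPair (false , true)  = 𝕦
fromPair (true  , true)  = 𝟙+𝕦

_+u_ : Z2u → Z2u → Z2u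
x +u y with toPair x | toPair y
... | a , b | c , d = fromPair (a xor c , b xor d)

-- (a + bu)(c + du) = ac + (ad + bc)u
_*u_ : Z2u → Z2u → Z2u
x *u y with toPair x | toPair y
... | a , b | c , d = fromPair (a ∧ c , (a ∧ d) xor (b ∧ c))

π : Z2u → Bool
π 𝟘   = false
π 𝟙   = true
π 𝕦   = false
π 𝟙+𝕦 = true

ψ : Z2u → Vec Bool 2
ψ 𝟘   = false ∷ false ∷ []
ψ 𝟙   = false ∷ true  ∷ []
ψ 𝕦   = true  ∷ true  ∷ []
ψ 𝟙+𝕦 = true  ∷ false ∷ []

Subset22u : ℕ → ℕ → Set₁
Subset22u α β = Vec Bool α → Vec Z2u β → Set

IsAdditive : ∀ {α β} → Subset22u α β → Set
IsAdditive {α} {β} 𝒞 =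
  𝒞 (replicate α false) (replicate β 𝟘) ×
  (∀ x x' y y' → 𝒞 x x' → 𝒞 y y' → 𝒞 (zipWith _xor_ x y) (zipWith _+u_ x' y')) ×
  (∀ l x x' → 𝒞 x x' → 𝒞 (map (λ a → π l ∧ a) x) (map (l *u_) x'))

Ψ : ∀ {α β} → Vec Bool α → Vec Z2u β → Word (α + β * 2)
Ψ x x' = x ++ concat (map ψ x')

IsZ2Z2uLinear : ∀ {n} → Code n → ℕ → ℕ → Set₁
IsZ2Z2uLinear {n} C α β =
  (α + β * 2 ≡ n) ×
  Σ (Vec (Fin n) (α + β * 2)) λ σ →
    Injective _≡_ _≡_ (lookup σ) ×
    Σ (Subset22u α β) λ 𝒞 →
      IsAdditive 𝒞 ×
      (∀ w → (T (C w) → ∃[ x ] ∃[ x' ] (𝒞 x x' × Ψ x x' ≡ permute σ w)) ×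
             ((∃[ x ] ∃[ x' ] (𝒞 x x' × Ψ x x' ≡ permute σ w)) → T (C w)))

-- Aut(C) has even order iff it contains a coordinate involution τ ≠ id: left multiplication by
-- such a τ is a fixed-point-free involution of Aut(C), while inversion is an involution of Aut(C)
-- fixing the identity, so counting fixed points modulo 2 yields a second one.
-- A Z₂Z₂[u]-structure with β > 0 gives such a τ, since multiplication by 1+u fixes the Z₂ part of
-- Ψ(x | x′) and swaps the two bits of each ψ(x′ₖ). Conversely, the fixed points of τ serve as Z₂
-- coordinates and its 2-cycles as the pairs ψ(x′ₖ); the preimage of C under Ψ is then closed under
-- addition because C is linear, under 1+u because τ preserves C, and 0 = 1+1, u = 1+(1+u).

module Submission where

open import Defs
open import Data.Bool using (Bool; true; false; _∧_; _∨_; not; _xor_; T; T?) renaming (_≟_ to _≟ᵇ_)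
open import Data.Bool.Properties using (T-irrelevant; T-∧; xor-same)
open import Data.Nat using (ℕ; zero; suc; _+_; _*_; _≤_; _<_; s≤s; parity)
open import Data.Nat.Properties using (≤-trans; ≤-refl; +-suc; 1+n≰n)
open import Data.Fin using (Fin; zero; suc; punchOut) renaming (_≟_ to _≟ᶠ_; _<_ to _<ᶠ_)
open import Data.Fin.Properties
  using ( suc-injective; any?; injective⇒≤; punchOut-injective; ¬∀⟶∃¬; <-cmp; <-irrefl; <-trans; <⇒≢
        ; cantor-schröder-bernstein)
  renaming (_<?_ to _<?ᶠ_)
open import Data.Fin.Permutation using (↔⇒≡)
open import Data.Vec as V using (Vec; []; _∷_)
open import Data.Vec.Properties
  using ( lookup-map; tabulate∘lookup; tabulate-cong; lookup∘tabulate; map-∘; map-cong; map-id; map-const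
        ; ≡-dec; lookup-allFin; map-lookup-allFin; zipWith-++; lookup-replicate; lookup-zipWith
        ; toList-++; toList∘fromList)
import Data.Vec.Relation.Unary.All.Properties as VAll
import Data.Vec.Relation.Unary.Any as VAny
import Data.Vec.Relation.Unary.Any.Properties as VAny
import Data.Vec.Membership.Propositional.Properties as VMem
import Data.Vec.Relation.Unary.Unique.Propositional as VUnique
import Data.Vec.Relation.Unary.Unique.Propositional.Properties as VUnique
open import Data.Vec.Relation.Unary.AllPairs using ([]; _∷_)
open import Data.List as L using (List; []; _∷_; length; filter; lookup; deduplicate; concatMap)
open import Data.List.Properties using (length-filter; filter-accept; filter-reject; filter-all; filter-some)
open import Data.List.Membership.Propositional using (_∈_; _∉_)
open import Data.List.Membership.Propositional.Properties
  using (∈-filter⁺; ∈-filter⁻; ∈-lookup; ∈-deduplicate⁺; ∈-concatMap⁺; ∈-map⁺; ∈-allFin; ∈-++⁺ˡ; ∈-++⁺ʳ)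
open import Data.List.Relation.Unary.Any as Any using (here; there; index)
open import Data.List.Relation.Unary.Any.Properties using (lookup-index)
open import Data.List.Relation.Unary.All as All using (_∷_)
open import Data.List.Relation.Unary.AllPairs using ([]; _∷_)
open import Data.List.Relation.Unary.Unique.Propositional using (Unique)
open import Data.List.Relation.Unary.Unique.Propositional.Properties using (filter⁺; allFin⁺; ++⁺)
open import Data.List.Relation.Unary.All.Properties using (all-filter)
open import Data.List.Relation.Unary.Unique.DecPropositional.Properties using (deduplicate-!)
open import Data.Product using (Σ; _×_; _,_; ∃-syntax; proj₁; proj₂)
open import Data.Sum using (_⊎_; inj₁; inj₂)
open import Data.Empty using (⊥-elim)
open import Data.Parity.Base using (0ℙ; 1ℙ; _⁻¹)
open import Data.Parity.Properties using (⁻¹-involutive; suc-homo-⁻¹; *-homo-*)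
open import Relation.Nullary using (¬_; Dec; yes; no; ¬?)
open import Relation.Nullary.Decidable using (⌊_⌋; _×-dec_)
open import Relation.Binary using (DecidableEquality; Tri; tri<; tri≈; tri>)
open import Relation.Binary.PropositionalEquality
  using (_≡_; _≢_; refl; sym; trans; cong; cong₂; subst; subst₂; module ≡-Reasoning)
open import Function.Base using (_∘_)
open import Function.Bundles using (_↔_; mk↔ₛ′; Inverse; Injection; _⇔_; mk⇔; Equivalence)
open import Function.Definitions using (Injective)
open import Function.Properties.Inverse using (↔-sym; ↔-trans; ↔⇒↣)

-- Finite types

involutive⇒injective : ∀ {A : Set} {f : A → A} → (∀ a → f (f a) ≡ a) → Injective _≡_ _≡_ f
involutive⇒injective {f = f} f-involutive {x} {y} e =
  trans (sym (f-involutive x)) (trans (cong f e) (f-involutive y))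

lookup-injective : ∀ {A : Set} {xs : List A} → Unique xs → Injective _≡_ _≡_ (lookup xs)
lookup-injective {xs = x ∷ xs} _          {zero}  {zero}  _ = refl
lookup-injective {xs = x ∷ xs} (x∉xs ∷ _) {zero}  {suc j} e = ⊥-elim (All.lookup x∉xs (∈-lookup j) e)
lookup-injective {xs = x ∷ xs} (x∉xs ∷ _) {suc i} {zero}  e = ⊥-elim (All.lookup x∉xs (∈-lookup i) (sym e))
lookup-injective {xs = x ∷ xs} (_ ∷ u)    {suc i} {suc j} e = cong suc (lookup-injective u e)

Fin-injective⇒surjective : ∀ {n} (f : Fin n → Fin n) → Injective _≡_ _≡_ f → ∀ j → ∃[ i ] f i ≡ j
Fin-injective⇒surjective {zero}  f _     ()
Fin-injective⇒surjective {suc n} f f-inj j with any? (λ i → f i ≟ᶠ j)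
... | yes hit = hit
... | no miss = ⊥-elim (1+n≰n (injective⇒≤ {f = skip-j} skip-j-injective))
  where
  skip-j : Fin (suc n) → Fin n
  skip-j i = punchOut (λ e → miss (i , sym e))
  skip-j-injective : Injective _≡_ _≡_ skip-j
  skip-j-injective {x} {y} e =
    f-inj (punchOut-injective (λ e → miss (x , sym e)) (λ e → miss (y , sym e)) e)

record Enumeration (A : Set) : Set where
  field
    _≟_      : DecidableEquality A
    elements : List A
    unique   : Unique elements
    complete : ∀ a → a ∈ elements

  size : ℕ
  size = length elements

  ↔Fin : A ↔ Fin size
  ↔Fin = mk↔ₛ′ (λ a → index (complete a)) (lookup elements)
    (λ i → lookup-injective unique (sym (lookup-index (complete (lookup elements i)))))
    (λ a → sym (lookup-index (complete a)))

  injective⇒surjective : (h : A → A) → Injective _≡_ _≡_ h → ∀ a → ∃[ b ] h b ≡ a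
  injective⇒surjective h h-inj a = from (proj₁ hit) , to-inj (proj₂ hit)
    where
    open Inverse ↔Fin
    to-inj   = Injection.injective (↔⇒↣ ↔Fin)
    from-inj = Injection.injective (↔⇒↣ (↔-sym ↔Fin))
    hit = Fin-injective⇒surjective (to ∘ h ∘ from) (λ e → from-inj (h-inj (to-inj e))) (to a)

Subtype : (X : Set) → (X → Bool) → Set
Subtype X P = Σ X (λ x → T (P x))

Subtype-≡ : ∀ {X : Set} {P : X → Bool} {a b : Subtype X P} → proj₁ a ≡ proj₁ b → a ≡ b
Subtype-≡ {a = x , p} {b = .x , q} refl = cong (x ,_) (T-irrelevant p q)

module _ {X : Set} (_≟X_ : DecidableEquality X) (xs : List X) (xs-complete : ∀ x → x ∈ xs)
         (P : X → Bool) where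

  private
    _≟_ : DecidableEquality (Subtype X P)
    (x , p) ≟ (y , q) with x ≟X y
    ... | yes refl = yes (Subtype-≡ refl)
    ... | no x≢y   = no (λ e → x≢y (cong proj₁ e))

    witnesses : List X → List (Subtype X P)
    witnesses []       = []
    witnesses (x ∷ ys) with T? (P x)
    ... | yes p = (x , p) ∷ witnesses ys
    ... | no  _ = witnesses ys

    ∈-witnesses : ∀ {x} ys (p : T (P x)) → x ∈ ys → (x , p) ∈ witnesses ys
    ∈-witnesses (y ∷ ys) p (here refl) with T? (P y)
    ... | yes _  = here (Subtype-≡ refl)
    ... | no ¬py = ⊥-elim (¬py p)
    ∈-witnesses (y ∷ ys) p (there x∈) with T? (P y)
    ... | yes _ = there (∈-witnesses ys p x∈)
    ... | no  _ = ∈-witnesses ys p x∈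

  subtypeEnumeration : Enumeration (Subtype X P)
  subtypeEnumeration = record
    { _≟_      = _≟_
    ; elements = deduplicate _≟_ (witnesses xs)
    ; unique   = deduplicate-! _≟_ (witnesses xs)
    ; complete = λ (x , p) → ∈-deduplicate⁺ _≟_ (∈-witnesses xs p (xs-complete x))
    }

-- Parity of the number of fixed points of an involution

parity-suc : ∀ n → parity (suc n) ≡ parity n ⁻¹
parity-suc n = trans (sym (⁻¹-involutive (parity (suc n)))) (cong _⁻¹ (suc-homo-⁻¹ n))

parity≡0ℙ⇒even : ∀ n → parity n ≡ 0ℙ → ∃[ k ] n ≡ 2 * k
parity≡0ℙ⇒even zero          _ = 0 , refl
parity≡0ℙ⇒even (suc (suc n)) p with k , refl ← parity≡0ℙ⇒even n p = suc k , cong suc (sym (+-suc k (k + 0)))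

module InvolutionParity {A : Set} (_≟_ : DecidableEquality A)
                        (f : A → A) (f-involutive : ∀ a → f (f a) ≡ a) where

  fixedPointCount : List A → ℕ
  fixedPointCount []       = 0
  fixedPointCount (x ∷ xs) with f x ≟ x
  ... | yes _ = suc (fixedPointCount xs)
  ... | no  _ = fixedPointCount xs

  Closed : List A → Set
  Closed xs = ∀ {x} → x ∈ xs → f x ∈ xs

  private
    f-injective : Injective _≡_ _≡_ f
    f-injective = involutive⇒injective f-involutive

    remove : A → List A → List A
    remove a = filter (λ y → ¬? (y ≟ a))

    remove-∉ : ∀ {a} xs → a ∉ xs → remove a xs ≡ xs
    remove-∉ xs a∉xs =
      filter-all (λ y → ¬? (y ≟ _)) (All.tabulate (λ y∈ y≡a → a∉xs (subst (_∈ xs) y≡a y∈)))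

    length-remove : ∀ {a} xs → Unique xs → a ∈ xs → suc (length (remove a xs)) ≡ length xs
    length-remove {a} (x ∷ xs) (x∉xs ∷ _) (here refl)
      rewrite filter-reject (λ y → ¬? (y ≟ a)) {x} {xs} (λ ne → ne refl)
            | remove-∉ xs (λ a∈ → All.lookup x∉xs a∈ refl) = refl
    length-remove {a} (x ∷ xs) (x∉xs ∷ u) (there a∈)
      rewrite filter-accept (λ y → ¬? (y ≟ a)) {x} {xs} (All.lookup x∉xs a∈)
      = cong suc (length-remove xs u a∈)

    fixedPointCount-remove : ∀ {a} xs → f a ≢ a → fixedPointCount (remove a xs) ≡ fixedPointCount xs
    fixedPointCount-remove []       _ = refl
    fixedPointCount-remove {a} (x ∷ xs) fa≢a with x ≟ a
    ... | yes refl with f x ≟ x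
    ...   | yes fx≡x = ⊥-elim (fa≢a fx≡x)
    ...   | no  _    = fixedPointCount-remove xs fa≢a
    fixedPointCount-remove {a} (x ∷ xs) fa≢a | no _ with f x ≟ x
    ...   | yes _ = cong suc (fixedPointCount-remove xs fa≢a)
    ...   | no  _ = fixedPointCount-remove xs fa≢a

    closed-remove : ∀ {x} xs → x ∉ xs → Closed (x ∷ xs) → Closed (remove (f x) xs)
    closed-remove {x} xs x∉xs closed {y} y∈ with ∈-filter⁻ (λ z → ¬? (z ≟ f x)) {xs = xs} y∈
    ... | y∈xs , y≢fx with closed (there y∈xs)
    ...   | here fy≡x = ⊥-elim (y≢fx (trans (sym (f-involutive y)) (cong f fy≡x)))
    ...   | there fy∈ =
      ∈-filter⁺ (λ z → ¬? (z ≟ f x)) fy∈ (λ fy≡fx → x∉xs (subst (_∈ xs) (f-injective fy≡fx) y∈xs))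

    parity-bounded : ∀ bound xs → length xs ≤ bound → Unique xs → Closed xs →
                     parity (length xs) ≡ parity (fixedPointCount xs)
    parity-bounded _           []         _         _              _      = refl
    parity-bounded (suc bound) (x ∷ rest) (s≤s len) (x∉rest ∷ u) closed with f x ≟ x
    ... | yes fx≡x = trans (parity-suc (length rest))
                       (trans (cong _⁻¹ (parity-bounded bound rest len u closed-rest))
                              (sym (parity-suc (fixedPointCount rest))))
      where
      closed-rest : Closed rest
      closed-rest {y} y∈ with closed (there y∈)
      ... | there fy∈ = fy∈
      ... | here fy≡x = ⊥-elim (All.lookup x∉rest y∈ (sym (f-injective (trans fy≡x (sym fx≡x)))))
    ... | no fx≢x = begin
        parity (suc (length rest))                ≡⟨ cong (parity ∘ suc) (sym (length-remove rest u fx∈rest)) ⟩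
        parity (length rest′)                     ≡⟨ parity-bounded bound rest′ len′ (filter⁺ _ u) closed′ ⟩
        parity (fixedPointCount rest′)            ≡⟨ cong parity (fixedPointCount-remove rest fx-moved) ⟩
        parity (fixedPointCount rest)             ∎
      where
      open ≡-Reasoning
      fx∈rest : f x ∈ rest
      fx∈rest with closed (here refl)
      ... | here fx≡x = ⊥-elim (fx≢x fx≡x)
      ... | there fx∈ = fx∈
      fx-moved : f (f x) ≢ f x
      fx-moved e = fx≢x (f-injective e)
      rest′ = remove (f x) rest
      len′ : length rest′ ≤ bound
      len′ = ≤-trans (length-filter _ rest) len
      closed′ : Closed rest′
      closed′ = closed-remove rest (λ x∈ → All.lookup x∉rest x∈ refl) closed

  fixedPointCount≡0 : ∀ xs → (∀ {a} → a ∈ xs → f a ≢ a) → fixedPointCount xs ≡ 0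
  fixedPointCount≡0 []       _         = refl
  fixedPointCount≡0 (x ∷ xs) no-fixed with f x ≟ x
  ... | yes fx≡x = ⊥-elim (no-fixed (here refl) fx≡x)
  ... | no  _    = fixedPointCount≡0 xs (no-fixed ∘ there)

  fixedPointCount≡1 : ∀ {e} xs → Unique xs → e ∈ xs → f e ≡ e → (∀ a → f a ≡ a → a ≡ e) →
                      fixedPointCount xs ≡ 1
  fixedPointCount≡1 (x ∷ xs) (x∉xs ∷ _) _ _ only-e with f x ≟ x
  ... | yes fx≡x = cong suc (fixedPointCount≡0 xs λ {a} a∈ fa≡a →
                     All.lookup x∉xs a∈ (trans (only-e x fx≡x) (sym (only-e a fa≡a))))
  fixedPointCount≡1 (x ∷ xs) _ (here refl) fe≡e _ | no fx≢x = ⊥-elim (fx≢x fe≡e)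
  fixedPointCount≡1 (x ∷ xs) (_ ∷ u) (there e∈) fe≡e only-e | no _ = fixedPointCount≡1 xs u e∈ fe≡e only-e

  parity-length≡parity-fixedPointCount : ∀ xs → Unique xs → Closed xs →
                                         parity (length xs) ≡ parity (fixedPointCount xs)
  parity-length≡parity-fixedPointCount xs = parity-bounded (length xs) xs ≤-refl

module _ {A : Set} (E : Enumeration A) (f : A → A) (f-involutive : ∀ a → f (f a) ≡ a) where
  open Enumeration E
  open InvolutionParity _≟_ f f-involutive

  private
    parity-size≡parity-fixedPointCount : parity size ≡ parity (fixedPointCount elements)
    parity-size≡parity-fixedPointCount =
      parity-length≡parity-fixedPointCount elements unique (λ {x} _ → complete (f x))

  fixedPointFree⇒evenOrder : (∀ a → f a ≢ a) → HasEvenOrder A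
  fixedPointFree⇒evenOrder no-fixed = k , subst (λ m → A ↔ Fin m) size≡2k ↔Fin
    where
    even = parity≡0ℙ⇒even size (trans parity-size≡parity-fixedPointCount
             (cong parity (fixedPointCount≡0 elements (λ {a} _ → no-fixed a))))
    k = proj₁ even
    size≡2k = proj₂ even

  evenOrder⇒secondFixedPoint : HasEvenOrder A → ∀ {e} → f e ≡ e → ∃[ a ] f a ≡ a × a ≢ e
  evenOrder⇒secondFixedPoint (k , A↔2k) {e} fe≡e
    with Any.any? (λ a → f a ≟ a ×-dec ¬? (a ≟ e)) elements
  ... | yes found = Any.satisfied found
  ... | no none   = ⊥-elim (1ℙ≢0ℙ (begin
      1ℙ                               ≡⟨ cong parity (sym (fixedPointCount≡1 elements unique (complete e) fe≡e only-e)) ⟩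
      parity (fixedPointCount elements) ≡⟨ sym parity-size≡parity-fixedPointCount ⟩
      parity size                      ≡⟨ cong parity (↔⇒≡ (↔-trans (↔-sym ↔Fin) A↔2k)) ⟩
      parity (2 * k)                   ≡⟨ *-homo-* 2 k ⟩
      0ℙ                               ∎))
    where
    open ≡-Reasoning
    1ℙ≢0ℙ : 1ℙ ≢ 0ℙ
    1ℙ≢0ℙ ()
    only-e : ∀ a → f a ≡ a → a ≡ e
    only-e a fa≡a with a ≟ e
    ... | yes a≡e = a≡e
    ... | no  a≢e = ⊥-elim (none (Any.map (λ { refl → fa≡a , a≢e }) (complete a)))

-- Coordinate permutations and Aut(C)

allWords-complete : ∀ n (w : Word n) → w ∈ allWords n
allWords-complete zero    []      = here refl
allWords-complete (suc n) (b ∷ w) =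
  ∈-concatMap⁺ _ (Any.map (λ { refl → ∈-extensions b }) (allWords-complete n w))
  where
  ∈-extensions : ∀ b → (b ∷ w) ∈ (false ∷ w) ∷ (true ∷ w) ∷ []
  ∈-extensions false = here refl
  ∈-extensions true  = there (here refl)

allVecs : ∀ {n} k → List (Vec (Fin n) k)
allVecs zero        = [] ∷ []
allVecs {n} (suc k) = concatMap (λ v → L.map (_∷ v) (L.allFin n)) (allVecs k)

allVecs-complete : ∀ {n} k (v : Vec (Fin n) k) → v ∈ allVecs k
allVecs-complete zero    []      = here refl
allVecs-complete (suc k) (i ∷ v) =
  ∈-concatMap⁺ _ (Any.map (λ { refl → ∈-map⁺ (_∷ v) (∈-allFin i) }) (allVecs-complete k v))

T-not-∨ : ∀ x y → T (not x ∨ y) ⇔ (T x → T y)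
T-not-∨ false _     = mk⇔ (λ _ ()) (λ _ → _)
T-not-∨ true  true  = mk⇔ (λ _ _ → _) (λ _ → _)
T-not-∨ true  false = mk⇔ (λ ()) (λ f → f _)

T-not-⌊⌋-∨-⌊⌋ : ∀ {P Q : Set} (p? : Dec P) (q? : Dec Q) → T (not ⌊ p? ⌋ ∨ ⌊ q? ⌋) ⇔ (P → Q)
T-not-⌊⌋-∨-⌊⌋ (yes _) (yes q) = mk⇔ (λ _ _ → q) _
T-not-⌊⌋-∨-⌊⌋ (no _)  (yes q) = mk⇔ (λ _ _ → q) _
T-not-⌊⌋-∨-⌊⌋ (yes p) (no ¬q) = mk⇔ (λ ()) (λ f → ¬q (f p))
T-not-⌊⌋-∨-⌊⌋ (no ¬p) (no _)  = mk⇔ (λ _ p → ⊥-elim (¬p p)) _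

T-allL : ∀ {A : Set} (p : A → Bool) xs → T (allL p xs) ⇔ (∀ {x} → x ∈ xs → T (p x))
T-allL p []       = mk⇔ (λ _ ()) (λ _ → _)
T-allL p (y ∷ xs) = mk⇔
  (λ t → λ { (here refl) → proj₁ (Equivalence.to T-∧ t)
           ; (there x∈)  → Equivalence.to (T-allL p xs) (proj₂ (Equivalence.to T-∧ t)) x∈ })
  (λ h → Equivalence.from T-∧ (h (here refl) , Equivalence.from (T-allL p xs) (λ x∈ → h (there x∈))))

lookup-extensionality : ∀ {A : Set} {n} {u v : Vec A n} → (∀ i → V.lookup u i ≡ V.lookup v i) → u ≡ v
lookup-extensionality {u = u} {v} h = trans (sym (tabulate∘lookup u)) (trans (tabulate-cong h) (tabulate∘lookup v))

lookup-permute : ∀ {m n} (σ : Vec (Fin n) m) (w : Word n) i → V.lookup (permute σ w) i ≡ V.lookup w (V.lookup σ i)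
lookup-permute σ w i = lookup-map i (V.lookup w) σ

map≡zipWith-self : ∀ {A B : Set} {f : A → B} {g : A → A → B} → (∀ a → f a ≡ g a a) →
                   ∀ {n} (xs : Vec A n) → V.map f xs ≡ V.zipWith g xs xs
map≡zipWith-self f≡g []       = refl
map≡zipWith-self f≡g (x ∷ xs) = cong₂ _∷_ (f≡g x) (map≡zipWith-self f≡g xs)

map≡zipWith-map : ∀ {A B : Set} {f : A → B} {g : A → A → B} {h : A → A} → (∀ a → f a ≡ g a (h a)) →
                  ∀ {n} (xs : Vec A n) → V.map f xs ≡ V.zipWith g xs (V.map h xs)
map≡zipWith-map f≡g []       = refl
map≡zipWith-map f≡g (x ∷ xs) = cong₂ _∷_ (f≡g x) (map≡zipWith-map f≡g xs)

permute-injective : ∀ {m n} (σ : Vec (Fin n) m) → (∀ j → ∃[ i ] V.lookup σ i ≡ j) →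
                    ∀ {w v} → permute σ w ≡ permute σ v → w ≡ v
permute-injective σ σ-surjective {w} {v} e = lookup-extensionality λ j →
  let i , σi≡j = σ-surjective j in begin
  V.lookup w j              ≡⟨ cong (V.lookup w) σi≡j ⟨
  V.lookup w (V.lookup σ i) ≡⟨ lookup-permute σ w i ⟨
  V.lookup (permute σ w) i  ≡⟨ cong (λ u → V.lookup u i) e ⟩
  V.lookup (permute σ v) i  ≡⟨ lookup-permute σ v i ⟩
  V.lookup v (V.lookup σ i) ≡⟨ cong (V.lookup v) σi≡j ⟩
  V.lookup v j              ∎
  where open ≡-Reasoning

permute-replicate : ∀ {m n} (σ : Vec (Fin n) m) b → permute σ (V.replicate n b) ≡ V.replicate m b
permute-replicate σ b = trans (map-cong (λ i → lookup-replicate i b) σ) (map-const σ b)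

permute-zipWith : ∀ {m n} (σ : Vec (Fin n) m) (f : Bool → Bool → Bool) w v →
                  permute σ (V.zipWith f w v) ≡ V.zipWith f (permute σ w) (permute σ v)
permute-zipWith σ f w v = lookup-extensionality λ i → begin
  V.lookup (permute σ (V.zipWith f w v)) i                   ≡⟨ lookup-permute σ (V.zipWith f w v) i ⟩
  V.lookup (V.zipWith f w v) (V.lookup σ i)                 ≡⟨ lookup-zipWith f _ w v ⟩
  f (V.lookup w (V.lookup σ i)) (V.lookup v (V.lookup σ i)) ≡⟨ cong₂ f (lookup-permute σ w i) (lookup-permute σ v i) ⟨
  f (V.lookup (permute σ w) i) (V.lookup (permute σ v) i)   ≡⟨ lookup-zipWith f i (permute σ w) (permute σ v) ⟨
  V.lookup (V.zipWith f (permute σ w) (permute σ v)) i       ∎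
  where open ≡-Reasoning

_⊙_ : ∀ {n} → Vec (Fin n) n → Vec (Fin n) n → Vec (Fin n) n
σ ⊙ ρ = V.map (V.lookup ρ) σ

lookup-⊙ : ∀ {n} (σ ρ : Vec (Fin n) n) i → V.lookup (σ ⊙ ρ) i ≡ V.lookup ρ (V.lookup σ i)
lookup-⊙ σ ρ i = lookup-map i (V.lookup ρ) σ

permute-⊙ : ∀ {n} (σ ρ : Vec (Fin n) n) w → permute (σ ⊙ ρ) w ≡ permute σ (permute ρ w)
permute-⊙ σ ρ w = begin
  V.map (V.lookup w) (V.map (V.lookup ρ) σ)  ≡⟨ map-∘ (V.lookup w) (V.lookup ρ) σ ⟨
  V.map (V.lookup w ∘ V.lookup ρ) σ          ≡⟨ map-cong (λ j → sym (lookup-permute ρ w j)) σ ⟩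
  V.map (V.lookup (permute ρ w)) σ           ∎
  where open ≡-Reasoning

module InverseTable {n} (σ : Vec (Fin n) n) (σ-injective : Injective _≡_ _≡_ (V.lookup σ)) where

  private
    σ-surjective : ∀ j → ∃[ i ] V.lookup σ i ≡ j
    σ-surjective = Fin-injective⇒surjective (V.lookup σ) σ-injective

  inverse : Vec (Fin n) n
  inverse = V.tabulate (proj₁ ∘ σ-surjective)

  lookup-σ-inverse : ∀ j → V.lookup σ (V.lookup inverse j) ≡ j
  lookup-σ-inverse j =
    trans (cong (V.lookup σ) (lookup∘tabulate (proj₁ ∘ σ-surjective) j)) (proj₂ (σ-surjective j))

  lookup-inverse-σ : ∀ i → V.lookup inverse (V.lookup σ i) ≡ i
  lookup-inverse-σ i = σ-injective (lookup-σ-inverse (V.lookup σ i))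

  inverse-injective : Injective _≡_ _≡_ (V.lookup inverse)
  inverse-injective {j} {k} e = trans (sym (lookup-σ-inverse j)) (trans (cong (V.lookup σ) e) (lookup-σ-inverse k))

  permute-inverse-σ : ∀ w → permute inverse (permute σ w) ≡ w
  permute-inverse-σ w = lookup-extensionality λ j → trans (lookup-permute inverse (permute σ w) j)
    (trans (lookup-permute σ w _) (cong (V.lookup w) (lookup-σ-inverse j)))

module Automorphisms {n} (C : Code n) where

  Preserves : Vec (Fin n) n → Set
  Preserves σ = ∀ w → T (C w) → T (C (permute σ w))

  IsAutomorphism : Vec (Fin n) n → Set
  IsAutomorphism σ = Injective _≡_ _≡_ (V.lookup σ) × Preserves σ

  private
    T-isPermutation : ∀ σ → T (isPermutation σ) ⇔ Injective _≡_ _≡_ (V.lookup σ)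
    T-isPermutation σ = mk⇔
      (λ t {i} {j} → Equivalence.to (T-not-⌊⌋-∨-⌊⌋ (σ⟨ i ⟩≟σ⟨ j ⟩) (i ≟ᶠ j))
         (Equivalence.to (T-allL (column i) (L.allFin n))
            (Equivalence.to (T-allL (λ i → allL (column i) (L.allFin n)) (L.allFin n)) t (∈-allFin i))
            (∈-allFin j)))
      (λ inj → Equivalence.from (T-allL (λ i → allL (column i) (L.allFin n)) (L.allFin n)) λ {i} _ →
         Equivalence.from (T-allL (column i) (L.allFin n)) λ {j} _ →
         Equivalence.from (T-not-⌊⌋-∨-⌊⌋ (σ⟨ i ⟩≟σ⟨ j ⟩) (i ≟ᶠ j)) inj)
      where
      σ⟨_⟩≟σ⟨_⟩ : ∀ i j → Dec (V.lookup σ i ≡ V.lookup σ j)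
      σ⟨ i ⟩≟σ⟨ j ⟩ = V.lookup σ i ≟ᶠ V.lookup σ j
      column : Fin n → Fin n → Bool
      column i j = not ⌊ σ⟨ i ⟩≟σ⟨ j ⟩ ⌋ ∨ ⌊ i ≟ᶠ j ⌋

    T-leavesInvariant : ∀ σ → T (leavesInvariant C σ) ⇔ Preserves σ
    T-leavesInvariant σ = mk⇔
      (λ t w → Equivalence.to (T-not-∨ (C w) _)
                 (Equivalence.to (T-allL invariantAt (allWords n)) t (allWords-complete n w)))
      (λ pres → Equivalence.from (T-allL invariantAt (allWords n)) λ {w} _ →
                  Equivalence.from (T-not-∨ (C w) _) (pres w))
      where
      invariantAt : Word n → Bool
      invariantAt x = not (C x) ∨ C (permute σ x)

  isAut⇔IsAutomorphism : ∀ σ → T (isAut C σ) ⇔ IsAutomorphism σ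
  isAut⇔IsAutomorphism σ = mk⇔
    (λ t → let p , l = Equivalence.to T-∧ t
           in (λ {i j} → Equivalence.to (T-isPermutation σ) p) , Equivalence.to (T-leavesInvariant σ) l)
    (λ (inj , pres) → Equivalence.from T-∧
      (Equivalence.from (T-isPermutation σ) (λ {i} {j} → inj {i} {j}) , Equivalence.from (T-leavesInvariant σ) pres))

  automorphism : ∀ {σ} → IsAutomorphism σ → Aut C
  automorphism {σ} aut = σ , Equivalence.from (isAut⇔IsAutomorphism σ) aut

  isAutomorphism : (a : Aut C) → IsAutomorphism (proj₁ a)
  isAutomorphism (σ , t) = Equivalence.to (isAut⇔IsAutomorphism σ) t

  autEnumeration : Enumeration (Aut C)
  autEnumeration = subtypeEnumeration (≡-dec _≟ᶠ_) (allVecs n) (allVecs-complete n) (isAut C)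

  ⊙-isAutomorphism : ∀ {σ ρ} → IsAutomorphism σ → IsAutomorphism ρ → IsAutomorphism (σ ⊙ ρ)
  ⊙-isAutomorphism {σ} {ρ} (σ-inj , σ-pres) (ρ-inj , ρ-pres) =
    (λ e → σ-inj (ρ-inj (trans (sym (lookup-⊙ σ ρ _)) (trans e (lookup-⊙ σ ρ _))))) ,
    (λ w w∈C → subst (T ∘ C) (sym (permute-⊙ σ ρ w)) (σ-pres _ (ρ-pres w w∈C)))

  -- σ maps the finite set of codewords injectively into itself, hence onto it
  inverse-preserves : ∀ {σ} (σ-inj : Injective _≡_ _≡_ (V.lookup σ)) → Preserves σ →
                      Preserves (InverseTable.inverse σ σ-inj)
  inverse-preserves {σ} σ-inj σ-pres x x∈C =
    subst (T ∘ C) (trans (sym (permute-inverse-σ w)) (cong (permute inverse ∘ proj₁) w↦x)) w∈C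
    where
    open InverseTable σ σ-inj
    codewords = subtypeEnumeration (≡-dec _≟ᵇ_) (allWords n) (allWords-complete n) C
    on-codewords : Subtype (Word n) C → Subtype (Word n) C
    on-codewords (w , w∈C) = permute σ w , σ-pres w w∈C
    on-codewords-injective : Injective _≡_ _≡_ on-codewords
    on-codewords-injective e =
      Subtype-≡ (permute-injective σ (Fin-injective⇒surjective (V.lookup σ) σ-inj) (cong proj₁ e))
    preimage = Enumeration.injective⇒surjective codewords on-codewords on-codewords-injective (x , x∈C)
    w   = proj₁ (proj₁ preimage)
    w∈C = proj₂ (proj₁ preimage)
    w↦x = proj₂ preimage

  invert : Aut C → Aut C
  invert a@(σ , _) = automorphism (inverse-injective , inverse-preserves σ-inj σ-pres)
    where
    σ-inj  = proj₁ (isAutomorphism a)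
    σ-pres = proj₂ (isAutomorphism a)
    open InverseTable σ σ-inj

  invert-involutive : ∀ a → invert (invert a) ≡ a
  invert-involutive a@(σ , _) = Subtype-≡ (lookup-extensionality λ i →
    σ⁻¹.inverse-injective (trans (σ⁻¹⁻¹.lookup-σ-inverse i) (sym (σ⁻¹.lookup-inverse-σ i))))
    where
    module σ⁻¹   = InverseTable σ (proj₁ (isAutomorphism a))
    module σ⁻¹⁻¹ = InverseTable (proj₁ (invert a)) (proj₁ (isAutomorphism (invert a)))

  identity : Aut C
  identity = automorphism
    ((λ {i} {j} e → trans (sym (lookup-allFin i)) (trans e (lookup-allFin j))) ,
     (λ w w∈C → subst (T ∘ C) (sym (map-lookup-allFin w)) w∈C))

  invert-identity : invert identity ≡ identity
  invert-identity = Subtype-≡ (lookup-extensionality λ j →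
    trans (sym (lookup-allFin _)) (trans (lookup-σ-inverse j) (sym (lookup-allFin j))))
    where open InverseTable (V.allFin n) (proj₁ (isAutomorphism identity))

  record NontrivialInvolution : Set where
    field
      τ          : Vec (Fin n) n
      involutive : ∀ i → V.lookup τ (V.lookup τ i) ≡ i
      nontrivial : ∃[ i ] V.lookup τ i ≢ i
      preserves  : Preserves τ

    τ-isAutomorphism : IsAutomorphism τ
    τ-isAutomorphism = involutive⇒injective involutive , preserves

  involution⇒evenOrder : NontrivialInvolution → HasEvenOrder (Aut C)
  involution⇒evenOrder ι = fixedPointFree⇒evenOrder autEnumeration τ⊙_ τ⊙-involutive τ⊙-fixedPointFree
    where
    open NontrivialInvolution ι
    τ⊙_ : Aut C → Aut C
    τ⊙ a = automorphism (⊙-isAutomorphism τ-isAutomorphism (isAutomorphism a))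
    τ⊙-involutive : ∀ a → τ⊙ (τ⊙ a) ≡ a
    τ⊙-involutive (ρ , _) = Subtype-≡ (lookup-extensionality λ i →
      trans (lookup-⊙ τ (τ ⊙ ρ) i) (trans (lookup-⊙ τ ρ _) (cong (V.lookup ρ) (involutive i))))
    τ⊙-fixedPointFree : ∀ a → τ⊙ a ≢ a
    τ⊙-fixedPointFree a@(ρ , _) e = proj₂ nontrivial (proj₁ (isAutomorphism a)
      (trans (sym (lookup-⊙ τ ρ _)) (cong (λ a → V.lookup (proj₁ a) (proj₁ nontrivial)) e)))

  evenOrder⇒involution : HasEvenOrder (Aut C) → NontrivialInvolution
  evenOrder⇒involution even = record
    { τ           = σ
    ; preserves   = proj₂ (isAutomorphism a)
    ; involutive  = λ i →
        trans (cong (λ b → V.lookup σ (V.lookup (proj₁ b) i)) (sym a⁻¹≡a)) (lookup-σ-inverse i)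
    ; nontrivial  = ¬∀⟶∃¬ n (λ i → V.lookup σ i ≡ i) (λ i → V.lookup σ i ≟ᶠ i)
                      (λ fixes-all → a≢identity (Subtype-≡ (lookup-extensionality λ i →
                         trans (fixes-all i) (sym (lookup-allFin i)))))
    }
    where
    fixed = evenOrder⇒secondFixedPoint autEnumeration invert invert-involutive even invert-identity
    a = proj₁ fixed
    a⁻¹≡a = proj₁ (proj₂ fixed)
    a≢identity = proj₂ (proj₂ fixed)
    σ = proj₁ a
    open InverseTable σ (proj₁ (isAutomorphism a))

-- The Gray map ψ and multiplication by 1+u

ψ-+u : ∀ a b → ψ (a +u b) ≡ V.zipWith _xor_ (ψ a) (ψ b)
ψ-+u 𝟘   𝟘   = refl
ψ-+u 𝟘   𝟙   = refl
ψ-+u 𝟘   𝕦   = refl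
ψ-+u 𝟘   𝟙+𝕦 = refl
ψ-+u 𝟙   𝟘   = refl
ψ-+u 𝟙   𝟙   = refl
ψ-+u 𝟙   𝕦   = refl
ψ-+u 𝟙   𝟙+𝕦 = refl
ψ-+u 𝕦   𝟘   = refl
ψ-+u 𝕦   𝟙   = refl
ψ-+u 𝕦   𝕦   = refl
ψ-+u 𝕦   𝟙+𝕦 = refl
ψ-+u 𝟙+𝕦 𝟘   = refl
ψ-+u 𝟙+𝕦 𝟙   = refl
ψ-+u 𝟙+𝕦 𝕦   = refl
ψ-+u 𝟙+𝕦 𝟙+𝕦 = refl

ψ-surjective : ∀ a b → ∃[ z ] ψ z ≡ a ∷ b ∷ []
ψ-surjective false false = 𝟘   , refl
ψ-surjective false true  = 𝟙   , refl
ψ-surjective true  true  = 𝕦   , refl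
ψ-surjective true  false = 𝟙+𝕦 , refl

𝟘*u≡+u-self : ∀ a → 𝟘 *u a ≡ a +u a
𝟘*u≡+u-self 𝟘   = refl
𝟘*u≡+u-self 𝟙   = refl
𝟘*u≡+u-self 𝕦   = refl
𝟘*u≡+u-self 𝟙+𝕦 = refl

𝟙*u-identity : ∀ a → 𝟙 *u a ≡ a
𝟙*u-identity 𝟘   = refl
𝟙*u-identity 𝟙   = refl
𝟙*u-identity 𝕦   = refl
𝟙*u-identity 𝟙+𝕦 = refl

𝕦*u≡+u-𝟙+𝕦*u : ∀ a → 𝕦 *u a ≡ a +u (𝟙+𝕦 *u a)
𝕦*u≡+u-𝟙+𝕦*u 𝟘   = refl
𝕦*u≡+u-𝟙+𝕦*u 𝟙   = refl
𝕦*u≡+u-𝟙+𝕦*u 𝕦   = refl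
𝕦*u≡+u-𝟙+𝕦*u 𝟙+𝕦 = refl

-- exchanges the two bits ψ(x′ₖ) of each Z₂[u] coordinate of Ψ(x | x′) and fixes the Z₂ coordinates
swapPairs : ∀ α β → Fin (α + β * 2) → Fin (α + β * 2)
swapPairs (suc α) β       zero          = zero
swapPairs (suc α) β       (suc i)       = suc (swapPairs α β i)
swapPairs zero    (suc β) zero          = suc zero
swapPairs zero    (suc β) (suc zero)    = zero
swapPairs zero    (suc β) (suc (suc i)) = suc (suc (swapPairs zero β i))

swapPairs-involutive : ∀ α β i → swapPairs α β (swapPairs α β i) ≡ i
swapPairs-involutive (suc α) β       zero          = refl
swapPairs-involutive (suc α) β       (suc i)       = cong suc (swapPairs-involutive α β i)
swapPairs-involutive zero    (suc β) zero          = refl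
swapPairs-involutive zero    (suc β) (suc zero)    = refl
swapPairs-involutive zero    (suc β) (suc (suc i)) = cong (λ j → suc (suc j)) (swapPairs-involutive zero β i)

firstPairCoordinate : ∀ α β → Fin (α + suc β * 2)
firstPairCoordinate zero    β = zero
firstPairCoordinate (suc α) β = suc (firstPairCoordinate α β)

swapPairs-moves-firstPairCoordinate : ∀ α β →
  swapPairs α (suc β) (firstPairCoordinate α β) ≢ firstPairCoordinate α β
swapPairs-moves-firstPairCoordinate zero    β ()
swapPairs-moves-firstPairCoordinate (suc α) β e = swapPairs-moves-firstPairCoordinate α β (suc-injective e)

lookup-Ψ-𝟙+𝕦 : ∀ {α β} (x : Vec Bool α) (x′ : Vec Z2u β) i →
  V.lookup (Ψ x (V.map (𝟙+𝕦 *u_) x′)) i ≡ V.lookup (Ψ x x′) (swapPairs α β i)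
lookup-Ψ-𝟙+𝕦 (a ∷ x) x′ zero = refl
lookup-Ψ-𝟙+𝕦 (a ∷ x) x′ (suc i) = lookup-Ψ-𝟙+𝕦 x x′ i
lookup-Ψ-𝟙+𝕦 [] (𝟘   ∷ x′) zero = refl
lookup-Ψ-𝟙+𝕦 [] (𝟙   ∷ x′) zero = refl
lookup-Ψ-𝟙+𝕦 [] (𝕦   ∷ x′) zero = refl
lookup-Ψ-𝟙+𝕦 [] (𝟙+𝕦 ∷ x′) zero = refl
lookup-Ψ-𝟙+𝕦 [] (𝟘   ∷ x′) (suc zero) = refl
lookup-Ψ-𝟙+𝕦 [] (𝟙   ∷ x′) (suc zero) = refl
lookup-Ψ-𝟙+𝕦 [] (𝕦   ∷ x′) (suc zero) = refl
lookup-Ψ-𝟙+𝕦 [] (𝟙+𝕦 ∷ x′) (suc zero) = refl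
lookup-Ψ-𝟙+𝕦 [] (𝟘   ∷ x′) (suc (suc i)) = lookup-Ψ-𝟙+𝕦 [] x′ i
lookup-Ψ-𝟙+𝕦 [] (𝟙   ∷ x′) (suc (suc i)) = lookup-Ψ-𝟙+𝕦 [] x′ i
lookup-Ψ-𝟙+𝕦 [] (𝕦   ∷ x′) (suc (suc i)) = lookup-Ψ-𝟙+𝕦 [] x′ i
lookup-Ψ-𝟙+𝕦 [] (𝟙+𝕦 ∷ x′) (suc (suc i)) = lookup-Ψ-𝟙+𝕦 [] x′ i

Ψ-zipWith : ∀ {α β} (x y : Vec Bool α) (x′ y′ : Vec Z2u β) →
  Ψ (V.zipWith _xor_ x y) (V.zipWith _+u_ x′ y′) ≡ V.zipWith _xor_ (Ψ x x′) (Ψ y y′)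
Ψ-zipWith (a ∷ x) (b ∷ y) x′ y′ = cong ((a xor b) ∷_) (Ψ-zipWith x y x′ y′)
Ψ-zipWith [] [] [] [] = refl
Ψ-zipWith [] [] (a ∷ x′) (b ∷ y′) = begin
  ψ (a +u b) V.++ Ψ [] (V.zipWith _+u_ x′ y′)
    ≡⟨ cong₂ V._++_ (ψ-+u a b) (Ψ-zipWith [] [] x′ y′) ⟩
  V.zipWith _xor_ (ψ a) (ψ b) V.++ V.zipWith _xor_ (Ψ [] x′) (Ψ [] y′)
    ≡⟨ zipWith-++ _xor_ (ψ a) (Ψ [] x′) (ψ b) (Ψ [] y′) ⟨
  V.zipWith _xor_ (ψ a V.++ Ψ [] x′) (ψ b V.++ Ψ [] y′) ∎
  where open ≡-Reasoning

Ψ-replicate : ∀ α β → Ψ (V.replicate α false) (V.replicate β 𝟘) ≡ V.replicate (α + β * 2) false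
Ψ-replicate (suc α) β       = cong (false ∷_) (Ψ-replicate α β)
Ψ-replicate zero    zero    = refl
Ψ-replicate zero    (suc β) = cong (λ v → false ∷ false ∷ v) (Ψ-replicate zero β)

Ψ-surjective : ∀ α β (v : Word (α + β * 2)) → ∃[ x ] ∃[ x′ ] Ψ {α} {β} x x′ ≡ v
Ψ-surjective (suc α) β (a ∷ v) with x , x′ , Ψxx′≡v ← Ψ-surjective α β v =
  a ∷ x , x′ , cong (a ∷_) Ψxx′≡v
Ψ-surjective zero zero [] = [] , [] , refl
Ψ-surjective zero (suc β) (a ∷ b ∷ v)
  with [] , x′ , Ψx′≡v ← Ψ-surjective zero β v | z , ψz ← ψ-surjective a b
  = [] , z ∷ x′ , cong₂ V._++_ ψz Ψx′≡v

-- σ sends each coordinate of Ψ to its position in the code; τ is the coordinate involution it induces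
module PairSwap {n α β} (σ : Vec (Fin n) (α + β * 2)) (τ : Vec (Fin n) n)
                (τσ≡σswap : ∀ i → V.lookup τ (V.lookup σ i) ≡ V.lookup σ (swapPairs α β i)) where

  Ψ-𝟙+𝕦 : ∀ w x x′ → Ψ x x′ ≡ permute σ w →
           Ψ x (V.map (𝟙+𝕦 *u_) x′) ≡ permute σ (permute τ w)
  Ψ-𝟙+𝕦 w x x′ Ψxx′≡σw = lookup-extensionality λ i → begin
    V.lookup (Ψ x (V.map (𝟙+𝕦 *u_) x′)) i   ≡⟨ lookup-Ψ-𝟙+𝕦 x x′ i ⟩
    V.lookup (Ψ x x′) (swapPairs α β i)      ≡⟨ cong (λ v → V.lookup v (swapPairs α β i)) Ψxx′≡σw ⟩
    V.lookup (permute σ w) (swapPairs α β i) ≡⟨ lookup-permute σ w _ ⟩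
    V.lookup w (V.lookup σ (swapPairs α β i)) ≡⟨ cong (V.lookup w) (τσ≡σswap i) ⟨
    V.lookup w (V.lookup τ (V.lookup σ i))   ≡⟨ lookup-permute τ w _ ⟨
    V.lookup (permute τ w) (V.lookup σ i)    ≡⟨ lookup-permute σ (permute τ w) i ⟨
    V.lookup (permute σ (permute τ w)) i     ∎
    where open ≡-Reasoning

  τ-involutive : (∀ j → ∃[ i ] V.lookup σ i ≡ j) → ∀ j → V.lookup τ (V.lookup τ j) ≡ j
  τ-involutive σ-surjective j with i , refl ← σ-surjective j = begin
    V.lookup τ (V.lookup τ (V.lookup σ i))          ≡⟨ cong (V.lookup τ) (τσ≡σswap i) ⟩
    V.lookup τ (V.lookup σ (swapPairs α β i))       ≡⟨ τσ≡σswap _ ⟩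
    V.lookup σ (swapPairs α β (swapPairs α β i))    ≡⟨ cong (V.lookup σ) (swapPairs-involutive α β i) ⟩
    V.lookup σ i                                    ∎
    where open ≡-Reasoning

  τ-moves : Injective _≡_ _≡_ (V.lookup σ) →
            ∀ i → swapPairs α β i ≢ i → V.lookup τ (V.lookup σ i) ≢ V.lookup σ i
  τ-moves σ-injective i moved e = moved (σ-injective (trans (sym (τσ≡σswap i)) e))

linear⇒nontrivialInvolution : ∀ {n} (C : Code n) {α β} → 0 < β → IsZ2Z2uLinear C α β →
                              Automorphisms.NontrivialInvolution C
linear⇒nontrivialInvolution C {α} {suc β} _
                            (refl , σ , σ-injective , 𝒞 , (_ , _ , 𝒞-scalar) , C↔𝒞) = record
  { τ          = τ
  ; involutive = τ-involutive (Fin-injective⇒surjective (V.lookup σ) σ-injective)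
  ; nontrivial = _ , τ-moves σ-injective _ (swapPairs-moves-firstPairCoordinate α β)
  ; preserves  = τ-preserves
  }
  where
  open InverseTable σ σ-injective
  τ : Vec (Fin (α + suc β * 2)) (α + suc β * 2)
  τ = V.tabulate (V.lookup σ ∘ swapPairs α (suc β) ∘ V.lookup inverse)
  τσ≡σswap : ∀ i → V.lookup τ (V.lookup σ i) ≡ V.lookup σ (swapPairs α (suc β) i)
  τσ≡σswap i = trans (lookup∘tabulate (V.lookup σ ∘ swapPairs α (suc β) ∘ V.lookup inverse) (V.lookup σ i))
                     (cong (V.lookup σ ∘ swapPairs α (suc β)) (lookup-inverse-σ i))
  open PairSwap {α = α} {β = suc β} σ τ τσ≡σswap
  τ-preserves : Automorphisms.Preserves C τ
  τ-preserves w w∈C with x , x′ , 𝒞xx′ , Ψxx′≡σw ← proj₁ (C↔𝒞 w) w∈C =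
    proj₂ (C↔𝒞 (permute τ w))
      (x , V.map (𝟙+𝕦 *u_) x′ ,
       subst (λ y → 𝒞 y (V.map (𝟙+𝕦 *u_) x′)) (map-id x) (𝒞-scalar 𝟙+𝕦 x x′ 𝒞xx′) ,
       Ψ-𝟙+𝕦 w x x′ Ψxx′≡σw)

-- A Z₂Z₂[u]-structure from a coordinate involution

toList-unique⁻ : ∀ {A : Set} {n} {xs : Vec A n} → Unique (V.toList xs) → VUnique.Unique xs
toList-unique⁻ {xs = []}     []         = []
toList-unique⁻ {xs = x ∷ xs} (x∉ ∷ u)  = VAll.toList⁻ x∉ ∷ toList-unique⁻ u

toList-lookup-surjective : ∀ {A : Set} {n} (xs : Vec A n) {y} → y ∈ V.toList xs → ∃[ i ] V.lookup xs i ≡ y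
toList-lookup-surjective xs y∈ = VAny.index y∈xs , sym (VAny.lookup-index y∈xs)
  where y∈xs = VMem.∈-toList⁻ y∈

module InvolutionLayout {n} (τ : Fin n → Fin n) (τ-involutive : ∀ i → τ (τ i) ≡ i) where

  private
    τ-injective : Injective _≡_ _≡_ τ
    τ-injective = involutive⇒injective τ-involutive

  fixedPoints : List (Fin n)
  fixedPoints = filter (λ i → τ i ≟ᶠ i) (L.allFin n)

  Leader : Fin n → Set
  Leader i = i <ᶠ τ i

  -- each two-element orbit {i, τ i} is represented by its smaller element
  leaders : List (Fin n)
  leaders = filter (λ i → i <?ᶠ τ i) (L.allFin n)

  α β : ℕ
  α = length fixedPoints
  β = length leaders

  orbit : Fin n → Vec (Fin n) 2
  orbit i = i ∷ τ i ∷ []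

  layout : Vec (Fin n) (α + β * 2)
  layout = V.fromList fixedPoints V.++ V.concat (V.map orbit (V.fromList leaders))

  ∈-fixedPoints⁻ : ∀ {j} → j ∈ fixedPoints → τ j ≡ j
  ∈-fixedPoints⁻ = proj₂ ∘ ∈-filter⁻ (λ i → τ i ≟ᶠ i) {xs = L.allFin n}

  ∈-leaders⁻ : ∀ {i} → i ∈ leaders → Leader i
  ∈-leaders⁻ = proj₂ ∘ ∈-filter⁻ (λ i → i <?ᶠ τ i) {xs = L.allFin n}

  ∈-leaders⁺ : ∀ {i} → Leader i → i ∈ leaders
  ∈-leaders⁺ {i} = ∈-filter⁺ (λ i → i <?ᶠ τ i) (∈-allFin i)

  orbits : List (Fin n) → List (Fin n)
  orbits []       = []
  orbits (i ∷ is) = i ∷ τ i ∷ orbits is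

  toList-orbits : ∀ is → V.toList (V.concat (V.map orbit (V.fromList is))) ≡ orbits is
  toList-orbits []       = refl
  toList-orbits (i ∷ is) = cong (λ l → i ∷ τ i ∷ l) (toList-orbits is)

  toList-layout : V.toList layout ≡ fixedPoints L.++ orbits leaders
  toList-layout = trans (toList-++ (V.fromList fixedPoints) _)
                        (cong₂ L._++_ (toList∘fromList fixedPoints) (toList-orbits leaders))

  ∈-orbits⁻ : ∀ {y} is → y ∈ orbits is → ∃[ i ] i ∈ is × (y ≡ i ⊎ y ≡ τ i)
  ∈-orbits⁻ (i ∷ is) (here y≡i)         = i , here refl , inj₁ y≡i
  ∈-orbits⁻ (i ∷ is) (there (here y≡τi)) = i , here refl , inj₂ y≡τi
  ∈-orbits⁻ (i ∷ is) (there (there y∈)) with j , j∈ , y≡ ← ∈-orbits⁻ is y∈ = j , there j∈ , y≡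

  ∈-orbits⁺ : ∀ {i} is → i ∈ is → i ∈ orbits is × τ i ∈ orbits is
  ∈-orbits⁺ (i ∷ is) (here refl) = here refl , there (here refl)
  ∈-orbits⁺ (j ∷ is) (there i∈)  = Data.Product.map (there ∘ there) (there ∘ there) (∈-orbits⁺ is i∈)

  leaders-disjoint : ∀ {i j} → Leader i → Leader j → τ i ≢ j
  leaders-disjoint {i} {j} i<τi j<τj τi≡j = <-irrefl refl (<-trans i<τi (subst (_<ᶠ i) (sym τi≡j) τj<i))
    where
    τj<i : j <ᶠ i
    τj<i = subst (j <ᶠ_) (trans (cong τ (sym τi≡j)) (τ-involutive i)) j<τj

  unique-orbits : ∀ is → Unique is → All.All Leader is → Unique (orbits is)
  unique-orbits []       _             _                = []
  unique-orbits (i ∷ is) (i∉is ∷ u) (i<τi ∷ leads) =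
    (<⇒≢ i<τi ∷ All.tabulate i∉orbits) ∷ All.tabulate τi∉orbits ∷ unique-orbits is u leads
    where
    i∉orbits : ∀ {y} → y ∈ orbits is → i ≢ y
    i∉orbits y∈ with ∈-orbits⁻ is y∈
    ... | j , j∈ , inj₁ refl = All.lookup i∉is j∈
    ... | j , j∈ , inj₂ refl = λ i≡τj →
      leaders-disjoint i<τi (All.lookup leads j∈) (trans (cong τ i≡τj) (τ-involutive j))
    τi∉orbits : ∀ {y} → y ∈ orbits is → τ i ≢ y
    τi∉orbits y∈ with ∈-orbits⁻ is y∈
    ... | j , j∈ , inj₁ refl = leaders-disjoint i<τi (All.lookup leads j∈)
    ... | j , j∈ , inj₂ refl = All.lookup i∉is j∈ ∘ τ-injective

  layout-unique : Unique (V.toList layout)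
  layout-unique = subst Unique (sym toList-layout) (++⁺ (filter⁺ _ (allFin⁺ n)) orbits-unique disjoint)
    where
    orbits-unique = unique-orbits leaders (filter⁺ _ (allFin⁺ n)) (all-filter _ (L.allFin n))
    disjoint : ∀ {j} → ¬ (j ∈ fixedPoints × j ∈ orbits leaders)
    disjoint (j∈fixed , j∈orbits) with ∈-orbits⁻ leaders j∈orbits
    ... | i , i∈ , inj₁ refl = <⇒≢ (∈-leaders⁻ i∈) (sym (∈-fixedPoints⁻ j∈fixed))
    ... | i , i∈ , inj₂ refl =
      <⇒≢ (∈-leaders⁻ i∈) (trans (sym (τ-involutive i)) (∈-fixedPoints⁻ j∈fixed))

  ∈-layout : ∀ j → j ∈ V.toList layout
  ∈-layout j = subst (j ∈_) (sym toList-layout) (∈-fixedPoints++orbits (<-cmp j (τ j)))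
    where
    ∈-fixedPoints++orbits : Tri (j <ᶠ τ j) (j ≡ τ j) (τ j <ᶠ j) → j ∈ fixedPoints L.++ orbits leaders
    ∈-fixedPoints++orbits (tri≈ _ j≡τj _) = ∈-++⁺ˡ (∈-filter⁺ (λ i → τ i ≟ᶠ i) (∈-allFin j) (sym j≡τj))
    ∈-fixedPoints++orbits (tri< j<τj _ _) = ∈-++⁺ʳ fixedPoints (proj₁ (∈-orbits⁺ leaders (∈-leaders⁺ j<τj)))
    ∈-fixedPoints++orbits (tri> _ _ τj<j) = ∈-++⁺ʳ fixedPoints (subst (_∈ orbits leaders) (τ-involutive j)
      (proj₂ (∈-orbits⁺ leaders (∈-leaders⁺ (subst (τ j <ᶠ_) (sym (τ-involutive j)) τj<j)))))

  layout-injective : Injective _≡_ _≡_ (V.lookup layout)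
  layout-injective = VUnique.lookup-injective (toList-unique⁻ layout-unique) _ _

  layout-surjective : ∀ j → ∃[ i ] V.lookup layout i ≡ j
  layout-surjective j = toList-lookup-surjective layout (∈-layout j)

  α+β*2≡n : α + β * 2 ≡ n
  α+β*2≡n = cantor-schröder-bernstein layout-injective
    (λ {j} {k} e → trans (sym (proj₂ (layout-surjective j)))
                         (trans (cong (V.lookup layout) e) (proj₂ (layout-surjective k))))

  β-positive : (∃[ i ] τ i ≢ i) → 0 < β
  β-positive (i , τi≢i) with <-cmp i (τ i)
  ... | tri< i<τi _ _ = filter-some _ (Any.map (λ { refl → i<τi }) (∈-allFin i))
  ... | tri≈ _ i≡τi _ = ⊥-elim (τi≢i (sym i≡τi))
  ... | tri> _ _ τi<i =
    filter-some _ (Any.map (λ { refl → subst (τ i <ᶠ_) (sym (τ-involutive i)) τi<i }) (∈-allFin (τ i)))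

  τ-orbits : ∀ is i → let v = V.concat (V.map orbit (V.fromList is)) in
             τ (V.lookup v i) ≡ V.lookup v (swapPairs 0 (length is) i)
  τ-orbits (j ∷ is) zero          = refl
  τ-orbits (j ∷ is) (suc zero)    = τ-involutive j
  τ-orbits (j ∷ is) (suc (suc i)) = τ-orbits is i

  τ-fixed-++ : ∀ js → All.All (λ j → τ j ≡ j) js → ∀ {m} (v : Vec (Fin n) (m * 2)) →
    (∀ i → τ (V.lookup v i) ≡ V.lookup v (swapPairs 0 m i)) →
    ∀ i → τ (V.lookup (V.fromList js V.++ v) i) ≡ V.lookup (V.fromList js V.++ v) (swapPairs (length js) m i)
  τ-fixed-++ []       _              v τv i       = τv i
  τ-fixed-++ (j ∷ js) (τj≡j ∷ _)     v τv zero    = τj≡j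
  τ-fixed-++ (j ∷ js) (_ ∷ fixed)    v τv (suc i) = τ-fixed-++ js fixed v τv i

  τ-layout : ∀ i → τ (V.lookup layout i) ≡ V.lookup layout (swapPairs α β i)
  τ-layout = τ-fixed-++ fixedPoints (all-filter _ (L.allFin n)) _ (τ-orbits leaders)

module FromInvolution {n} (C : Code n) (C-linear : IsBinaryLinear C) (ι : Automorphisms.NontrivialInvolution C) where
  open Automorphisms.NontrivialInvolution ι
  open InvolutionLayout (V.lookup τ) involutive
  open PairSwap {α = α} {β = β} layout τ τ-layout

  𝒞 : Subset22u α β
  𝒞 x x′ = ∃[ w ] T (C w) × Ψ x x′ ≡ permute layout w

  𝒞-zero : 𝒞 (V.replicate α false) (V.replicate β 𝟘)
  𝒞-zero = V.replicate n false , proj₁ C-linear , trans (Ψ-replicate α β) (sym (permute-replicate layout false))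

  𝒞-+ : ∀ x x′ y y′ → 𝒞 x x′ → 𝒞 y y′ → 𝒞 (V.zipWith _xor_ x y) (V.zipWith _+u_ x′ y′)
  𝒞-+ x x′ y y′ (w , w∈C , Ψxx′≡σw) (v , v∈C , Ψyy′≡σv) =
    V.zipWith _xor_ w v , proj₂ C-linear w v w∈C v∈C ,
    trans (Ψ-zipWith x y x′ y′)
          (trans (cong₂ (V.zipWith _xor_) Ψxx′≡σw Ψyy′≡σv) (sym (permute-zipWith layout _xor_ w v)))

  𝒞-𝟙+𝕦 : ∀ x x′ → 𝒞 x x′ → 𝒞 x (V.map (𝟙+𝕦 *u_) x′)
  𝒞-𝟙+𝕦 x x′ (w , w∈C , Ψxx′≡σw) = permute τ w , preserves w w∈C , Ψ-𝟙+𝕦 w x x′ Ψxx′≡σw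

  𝒞-scalar : ∀ l x x′ → 𝒞 x x′ → 𝒞 (V.map (λ a → π l ∧ a) x) (V.map (l *u_) x′)
  𝒞-scalar 𝟘 x x′ c = subst₂ 𝒞
    (sym (map≡zipWith-self (sym ∘ xor-same) x)) (sym (map≡zipWith-self 𝟘*u≡+u-self x′)) (𝒞-+ x x′ x x′ c c)
  𝒞-scalar 𝟙 x x′ c = subst₂ 𝒞 (sym (map-id x)) (sym (trans (map-cong 𝟙*u-identity x′) (map-id x′))) c
  𝒞-scalar 𝕦 x x′ c = subst₂ 𝒞
    (sym (map≡zipWith-self (sym ∘ xor-same) x))
    (sym (map≡zipWith-map 𝕦*u≡+u-𝟙+𝕦*u x′))
    (𝒞-+ x x′ x (V.map (𝟙+𝕦 *u_) x′) c (𝒞-𝟙+𝕦 x x′ c))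
  𝒞-scalar 𝟙+𝕦 x x′ c = subst (λ y → 𝒞 y (V.map (𝟙+𝕦 *u_) x′)) (sym (map-id x)) (𝒞-𝟙+𝕦 x x′ c)

  isZ2Z2uLinear : IsZ2Z2uLinear C α β
  isZ2Z2uLinear = α+β*2≡n , layout , layout-injective , 𝒞 , (𝒞-zero , 𝒞-+ , 𝒞-scalar) , λ w →
    (λ w∈C → let x , x′ , Ψxx′≡σw = Ψ-surjective α β (permute layout w)
             in x , x′ , (w , w∈C , Ψxx′≡σw) , Ψxx′≡σw) ,
    (λ (_ , _ , (v , v∈C , Ψxx′≡σv) , Ψxx′≡σw) →
       subst (T ∘ C) (permute-injective layout layout-surjective (trans (sym Ψxx′≡σv) Ψxx′≡σw)) v∈C)

nontrivialInvolution⇒linear : ∀ {n} (C : Code n) → IsBinaryLinear C → Automorphisms.NontrivialInvolution C →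
                              ∃[ α ] ∃[ β ] (0 < β × IsZ2Z2uLinear C α β)
nontrivialInvolution⇒linear C C-linear ι = α , β , β-positive nontrivial , isZ2Z2uLinear
  where
  open Automorphisms.NontrivialInvolution ι
  open InvolutionLayout (V.lookup τ) involutive using (α; β; β-positive)
  open FromInvolution C C-linear ι using (isZ2Z2uLinear)

corollary2 : ∀ (n : ℕ) (C : Code n) → IsBinaryLinear C →
    ((∃[ α ] ∃[ β ] (0 < β × IsZ2Z2uLinear C α β)) → HasEvenOrder (Aut C)) ×
    (HasEvenOrder (Aut C) → ∃[ α ] ∃[ β ] (0 < β × IsZ2Z2uLinear C α β))
corollary2 n C C-linear =
  (λ (_ , _ , β>0 , linear) → involution⇒evenOrder (linear⇒nontrivialInvolution C β>0 linear)) ,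
  (λ even → nontrivialInvolution⇒linear C C-linear (evenOrder⇒involution even))
  where open Automorphisms C using (involution⇒evenOrder; evenOrder⇒involution)
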